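{- Let $p$ be a nonempty binary word of length $l$ whose maximum run size is $i$. Then $p$ does not have an internal zero at $l+1$ if and only if, for every $j \in \{1,\dots,i\}$, $p$ has a run of size $j$.
   Context: A binary word is a finite sequence over $\{0,1\}$. An occurrence of $p = p_1\cdots p_l$ in $w = w_1\cdots w_n$ is a choice of indices $1 \le i_1 < \cdots < i_l \le n$ with $w_{i_1}\cdots w_{i_l} = p$; $c_p(w)$ is the number of occurrences, and $B_{n,p}(k)$ is the number of binary words $w$ of length $n$ with $c_p(w)=k$. A run is a maximal block of consecutive equal letters; its size is its length. The word $p$ has an internal zero at $n$ if there exist $0 \le k_1 < k_2 < k_3$ with $B_{n,p}(k_1) \ne 0$, $B_{n,p}(k_3) \ne 0$ and $B_{n,p}(k_2) = 0$. -}

module Defs where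

open import Data.Bool using (Bool; true; false; _∧_; if_then_else_)
open import Data.Bool.Properties using () renaming (_≟_ to _≟ᵇ_)
open import Data.Nat using (ℕ; zero; suc; _+_; _⊔_; _<_; _≤_)
open import Data.List using (List; []; _∷_; length; map; _++_; foldr; filter)
open import Data.List.Membership.Propositional using (_∈_)
open import Data.Product using (∃; _×_; _,_)
open import Relation.Nullary using (¬_; Dec; yes; no)
open import Relation.Binary.PropositionalEquality using (_≡_)
import Data.Nat as ℕ

-- Binary words: lists over {0,1}, with 0 = false and 1 = true.
Word : Set
Word = List Bool

-- c p w : number of occurrences of p in w as a (scattered) subsequence,
-- i.e. number of index choices i₁ < … < i_l with w_{i₁}⋯w_{i_l} = p.
-- Standard recursion: an occurrence either does not use the first letter
-- of w, or uses it to match the first letter of p.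
c : Word → Word → ℕ
c []      w        = 1
c (_ ∷ _) []       = 0
c (a ∷ p) (b ∷ w) with a ≟ᵇ b
... | yes _ = c (a ∷ p) w + c p w
... | no  _ = c (a ∷ p) w

words : ℕ → List Word
words zero    = [] ∷ []
words (suc n) = map (false ∷_) (words n) ++ map (true ∷_) (words n)

B : ℕ → Word → ℕ → ℕ
B n p k = length (filter (λ w → c p w ℕ.≟ k) (words n))

HasInternalZero : Word → ℕ → Set
HasInternalZero p n =
  ∃ λ k₁ → ∃ λ k₂ → ∃ λ k₃ →
    k₁ < k₂ × k₂ < k₃ × ¬ (B n p k₁ ≡ 0) × ¬ (B n p k₃ ≡ 0) × B n p k₂ ≡ 0

runsFrom : Bool → ℕ → Word → List ℕ
runsFrom a m []      = m ∷ []
runsFrom a m (b ∷ w) with a ≟ᵇ b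
... | yes _ = runsFrom a (suc m) w
... | no  _ = m ∷ runsFrom b 1 w

runs : Word → List ℕ
runs []      = []
runs (a ∷ w) = runsFrom a 1 w

maxRun : Word → ℕ
maxRun p = foldr _⊔_ 0 (runs p)

HasRunOfSize : Word → ℕ → Set
HasRunOfSize p j = j ∈ runs p

-- For |w| = |p| + 1, an occurrence of p in w is a deletion of one letter of w, and deleting any
-- letter of the same run of w gives the same word. Hence c p w is 0, 1 (the inserted letter forms
-- a run of its own) or r + 1 for a run of p of size r (the inserted letter lengthens that run),
-- and each of 1 and r + 1 is attained. So the attained counts form the interval {1, …, i + 1},
-- possibly together with 0, exactly when every run size 1, …, i occurs in p; a missing run size
-- j < i leaves the gap 1 < j + 1 < i + 1.
module Submission where

open import Defs
open import Data.Nat using (ℕ; suc; _≤_)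
open import Data.List using (length; [])
open import Relation.Binary.PropositionalEquality using (_≡_)
open import Relation.Nullary using (¬_)
open import Function.Bundles using (_⇔_)

open import Data.Bool using (Bool; true; false; not)
open import Data.Bool.Properties using (not-¬) renaming (_≟_ to _≟ᵇ_)
open import Data.Nat using (zero; _+_; _<_; z≤n; s≤s; _≤?_)
import Data.Nat as ℕ
open import Data.Nat.Properties
  using (+-comm; +-suc; ⊔-sel; m≤n⇒m≤n⊔o; m≤n⇒m≤o⊔n; m≤n⇒m≤1+n; ≤-refl; ≤-reflexive; ≤-trans;
         ≤-pred; <⇒≤; ≤∧≢⇒<; suc-injective; 1+n≢0)
open import Data.List using (List; _∷_; map)
open import Data.List.Properties using (filter-none; foldr-preservesᵒ)
open import Data.List.Membership.Propositional using (_∈_; _∉_)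
open import Data.List.Membership.Propositional.Properties
  using (∈-filter⁺; foldr-selective; ∈-++⁺ˡ; ∈-++⁺ʳ; ∈-++⁻; ∈-map⁺; ∈-map⁻)
open import Data.List.Membership.DecPropositional ℕ._≟_ using (_∈?_)
import Data.List.Relation.Unary.All as All
open import Data.List.Relation.Unary.Any as Any using (here; there)
open import Data.Product using (_×_; _,_; ∃-syntax)
import Data.Product as Product
open import Data.Sum using (_⊎_; inj₁; inj₂)
import Data.Sum as Sum
open import Function using (_∘_)
open import Function.Bundles using (mk⇔)
open import Relation.Nullary using (yes; no; contradiction)
open import Relation.Nullary.Decidable using (decidable-stable)
open import Relation.Binary.PropositionalEquality using (refl; sym; trans; cong; cong₂; subst; _≢_)

not-≢ : ∀ x → not x ≢ x
not-≢ x = not-¬ refl ∘ sym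

firstRun : Bool → Word → ℕ
firstRun a []      = 1
firstRun a (b ∷ w) with a ≟ᵇ b
... | yes _ = suc (firstRun b w)
... | no  _ = 1

-- laterRuns a w lists the runs of a ∷ w after the first one; equivalently, the runs of w
-- that do not continue a run ending in the letter a.
laterRuns : Bool → Word → List ℕ
laterRuns a []      = []
laterRuns a (b ∷ w) with a ≟ᵇ b
... | yes _ = laterRuns b w
... | no  _ = firstRun b w ∷ laterRuns b w

runsFrom-suc : ∀ a m w → runsFrom a (suc m) w ≡ (m + firstRun a w) ∷ laterRuns a w
runsFrom-suc a m []      = cong (_∷ []) (+-comm 1 m)
runsFrom-suc a m (b ∷ w) with a ≟ᵇ b
... | yes refl = trans (runsFrom-suc a (suc m) w) (cong (_∷ laterRuns a w) (sym (+-suc m _)))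
... | no  _    = cong₂ _∷_ (+-comm 1 m) (runsFrom-suc b 0 w)

runs-∷ : ∀ a w → runs (a ∷ w) ≡ firstRun a w ∷ laterRuns a w
runs-∷ a w = runsFrom-suc a 0 w

laterRuns-≢ : ∀ {b d} q → b ≢ d → laterRuns b (d ∷ q) ≡ runs (d ∷ q)
laterRuns-≢ {b} {d} q b≢d with b ≟ᵇ d
... | yes b≡d = contradiction b≡d b≢d
... | no  _   = sym (runs-∷ d q)

laterRuns-∷⁺ : ∀ b d q {r} → r ∈ laterRuns d q → r ∈ laterRuns b (d ∷ q)
laterRuns-∷⁺ b d q r∈ with b ≟ᵇ d
... | yes _ = r∈
... | no  _ = there r∈

laterRuns-∷⁻ : ∀ b d q {r} → r ∈ laterRuns b (d ∷ q) → r ∈ laterRuns d q ⊎ (b ≢ d × r ≡ firstRun d q)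
laterRuns-∷⁻ b d q r∈ with b ≟ᵇ d
... | yes _   = inj₁ r∈
... | no  b≢d with r∈
...   | here r≡  = inj₂ (b≢d , r≡)
...   | there r∈′ = inj₁ r∈′

laterRuns⊆runs : ∀ b p {r} → r ∈ laterRuns b p → r ∈ runs p
laterRuns⊆runs b (d ∷ q) {r} r∈ with laterRuns-∷⁻ b d q r∈
... | inj₁ r∈′       = subst (r ∈_) (sym (runs-∷ d q)) (there r∈′)
... | inj₂ (_ , refl) = subst (r ∈_) (sym (runs-∷ d q)) (here refl)

run≤maxRun : ∀ p {r} → r ∈ runs p → r ≤ maxRun p
run≤maxRun p {r} r∈ =
  foldr-preservesᵒ {P = r ≤_} (λ x y → Sum.[ m≤n⇒m≤n⊔o y , m≤n⇒m≤o⊔n x ]) 0 (runs p)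
    (inj₂ (Any.map ≤-reflexive r∈))

c-∷-same : ∀ a p w → c (a ∷ p) (a ∷ w) ≡ c (a ∷ p) w + c p w
c-∷-same a p w with a ≟ᵇ a
... | yes _   = refl
... | no  a≢a = contradiction refl a≢a

c-∷-≢ : ∀ {a b} p w → a ≢ b → c (a ∷ p) (b ∷ w) ≡ c (a ∷ p) w
c-∷-≢ {a} {b} p w a≢b with a ≟ᵇ b
... | yes a≡b = contradiction a≡b a≢b
... | no  _   = refl

c-short : ∀ p w → length w < length p → c p w ≡ 0
c-short []      w       ()
c-short (a ∷ p) []      _             = refl
c-short (a ∷ p) (b ∷ w) (s≤s |w|<|p|) with a ≟ᵇ b
... | yes _ = cong₂ _+_ (c-short (a ∷ p) w (m≤n⇒m≤1+n |w|<|p|)) (c-short p w |w|<|p|)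
... | no  _ = c-short (a ∷ p) w (m≤n⇒m≤1+n |w|<|p|)

c-self : ∀ p → c p p ≡ 1
c-self []      = refl
c-self (a ∷ p) with a ≟ᵇ a
... | yes _   = cong₂ _+_ (c-short (a ∷ p) p ≤-refl) (c-self p)
... | no  a≢a = contradiction refl a≢a

c-sameLength : ∀ p w → length w ≡ length p → c p w ≡ 0 ⊎ w ≡ p
c-sameLength []      []      _  = inj₂ refl
c-sameLength (a ∷ p) (b ∷ w) eq with a ≟ᵇ b
... | no  _    = inj₁ (c-short (a ∷ p) w (≤-reflexive eq))
... | yes refl with c-sameLength p w (suc-injective eq)
...   | inj₁ c≡0 = inj₁ (cong₂ _+_ (c-short (a ∷ p) w (≤-reflexive eq)) c≡0)
...   | inj₂ refl = inj₂ refl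

c-sameLength-≤1 : ∀ p w → length w ≡ length p → c p w ≤ 1
c-sameLength-≤1 p w eq with c-sameLength p w eq
... | inj₁ c≡0 = subst (_≤ 1) (sym c≡0) z≤n
... | inj₂ refl = ≤-reflexive (c-self p)

c-∷-≡0 : ∀ b d q w → length w ≡ length q → c q w ≡ 0 → c (b ∷ q) (d ∷ w) ≡ 0
c-∷-≡0 b d q w |w| c≡0 with b ≟ᵇ d
... | yes _ = cong₂ _+_ (c-short (b ∷ q) w (s≤s (≤-reflexive |w|))) c≡0
... | no  _ = c-short (b ∷ q) w (s≤s (≤-reflexive |w|))

c-∷-self : ∀ x q → c q (x ∷ q) ≡ firstRun x q
c-∷-self x []      = refl
c-∷-self x (d ∷ q) with x ≟ᵇ d
... | yes refl = trans (c-∷-same x q (x ∷ q)) (cong₂ _+_ (c-self (x ∷ q)) (c-∷-self x q))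
... | no  x≢d  = trans (c-∷-≢ q (d ∷ q) (x≢d ∘ sym)) (c-self (d ∷ q))

AtMostOneOrSucOf : List ℕ → ℕ → Set
AtMostOneOrSucOf rs k = k ≤ 1 ⊎ ∃[ r ] r ∈ rs × k ≡ suc r

AtMostOneOrSucOf-mono : ∀ {rs ss k} → (∀ {r} → r ∈ rs → r ∈ ss) →
                        AtMostOneOrSucOf rs k → AtMostOneOrSucOf ss k
AtMostOneOrSucOf-mono rs⊆ss = Sum.map₂ (Product.map₂ (Product.map₁ rs⊆ss))

-- Excluding w = b ∷ q excludes exactly the count that would lengthen a first run of q
-- continuing the letter b.
count-after : ∀ b q w → length w ≡ suc (length q) → c (b ∷ q) w ≡ 0 →
              AtMostOneOrSucOf (laterRuns b q) (c q w)
count-after b []      w       _   _   = inj₁ ≤-refl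
count-after b (d ∷ q) (y ∷ w) |w| p∉w with d ≟ᵇ y
... | no  _ = inj₁ (c-sameLength-≤1 (d ∷ q) w (suc-injective |w|))
... | yes refl with c-sameLength (d ∷ q) w (suc-injective |w|)
...   | inj₁ c≡0 =
  subst (AtMostOneOrSucOf _) (sym (cong (_+ c q w) c≡0))
    (AtMostOneOrSucOf-mono (laterRuns-∷⁺ b d q) (count-after d q w (suc-injective |w|) c≡0))
...   | inj₂ refl =
  inj₂ (firstRun d q , firstRun∈ , cong₂ _+_ (c-self (d ∷ q)) (c-∷-self d q))
  where
  b≢d : b ≢ d
  b≢d refl = 1+n≢0 (trans (sym (c-self (d ∷ d ∷ q))) p∉w)
  firstRun∈ : firstRun d q ∈ laterRuns b (d ∷ q)
  firstRun∈ = subst (_ ∈_) (sym (trans (laterRuns-≢ q b≢d) (runs-∷ d q))) (here refl)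

realize-later : ∀ b q {r} → r ∈ laterRuns b q →
                ∃[ w ] length w ≡ suc (length q) × c q w ≡ suc r × c (b ∷ q) w ≡ 0
realize-later b (d ∷ q) r∈ with laterRuns-∷⁻ b d q r∈
... | inj₂ (b≢d , refl) =
  d ∷ d ∷ q , refl ,
  trans (c-∷-same d q (d ∷ q)) (cong₂ _+_ (c-self (d ∷ q)) (c-∷-self d q)) ,
  trans (c-∷-≢ (d ∷ q) (d ∷ q) b≢d) (c-short (b ∷ d ∷ q) (d ∷ q) ≤-refl)
... | inj₁ r∈′ with realize-later d q r∈′
...   | w , |w| , q∈w , p∉w =
  d ∷ w , cong suc |w| , trans (c-∷-same d q w) (cong₂ _+_ p∉w q∈w) , c-∷-≡0 b d (d ∷ q) w |w| p∉w

Attained : ℕ → Word → ℕ → Set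
Attained n p k = ∃[ w ] length w ≡ n × c p w ≡ k

-- Any letter other than the first letter of w meets the hypothesis of count-after.
attained-shape : ∀ p {k} → Attained (suc (length p)) p k → AtMostOneOrSucOf (runs p) k
attained-shape p ([]    , ()  , _)
attained-shape p (y ∷ w , |w| , refl) =
  AtMostOneOrSucOf-mono (laterRuns⊆runs (not y) p) (count-after (not y) p (y ∷ w) |w| p∉w)
  where
  p∉w : c (not y ∷ p) (y ∷ w) ≡ 0
  p∉w = trans (c-∷-≢ p w (not-≢ y)) (c-short (not y ∷ p) w (≤-reflexive |w|))

attained-≤ : ∀ p {k} → Attained (suc (length p)) p k → k ≤ suc (maxRun p)
attained-≤ p att with attained-shape p att
... | inj₁ k≤1            = ≤-trans k≤1 (s≤s z≤n)
... | inj₂ (r , r∈ , refl) = s≤s (run≤maxRun p r∈)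

attained-one : ∀ p → Attained (suc (length p)) p 1
attained-one []      = true ∷ [] , refl , refl
attained-one (d ∷ q) = not d ∷ d ∷ q , refl , trans (c-∷-≢ q (d ∷ q) (not-¬ {d} refl)) (c-self (d ∷ q))

attained-run : ∀ p {r} → r ∈ runs p → Attained (suc (length p)) p (suc r)
attained-run (d ∷ q) r∈ with realize-later (not d) (d ∷ q) (subst (_ ∈_) (sym (laterRuns-≢ q (not-≢ d))) r∈)
... | w , |w| , p∈w , _ = w , |w| , p∈w

∈-words : ∀ w → w ∈ words (length w)
∈-words []        = here refl
∈-words (false ∷ w) = ∈-++⁺ˡ (∈-map⁺ (false ∷_) (∈-words w))
∈-words (true ∷ w)  = ∈-++⁺ʳ (map (false ∷_) (words (length w))) (∈-map⁺ (true ∷_) (∈-words w))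

words-length : ∀ n {w} → w ∈ words n → length w ≡ n
words-length zero    (here refl) = refl
words-length (suc n) w∈ with ∈-++⁻ (map (false ∷_) (words n)) w∈
... | inj₁ w∈₀ with ∈-map⁻ (false ∷_) w∈₀
...   | v , v∈ , refl = cong suc (words-length n v∈)
words-length (suc n) w∈ | inj₂ w∈₁ with ∈-map⁻ (true ∷_) w∈₁
...   | v , v∈ , refl = cong suc (words-length n v∈)

attained⇒B≢0 : ∀ {n} p {k} → Attained n p k → B n p k ≢ 0
attained⇒B≢0 p {k} (w , refl , c≡k) = nonempty (∈-filter⁺ (λ v → c p v ℕ.≟ k) (∈-words w) c≡k)
  where
  nonempty : ∀ {xs : List Word} → w ∈ xs → length xs ≢ 0
  nonempty (here _)  ()
  nonempty (there _) ()

¬attained⇒B≡0 : ∀ {n} p {k} → ¬ Attained n p k → B n p k ≡ 0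
¬attained⇒B≡0 {n} p {k} ¬att =
  cong length (filter-none (λ v → c p v ℕ.≟ k) (All.tabulate λ v∈ c≡k → ¬att (_ , words-length n v∈ , c≡k)))

B≢0⇒≤ : ∀ p {k} → B (suc (length p)) p k ≢ 0 → k ≤ suc (maxRun p)
B≢0⇒≤ p {k} B≢0 = decidable-stable (k ≤? suc (maxRun p)) (B≢0 ∘ ¬attained⇒B≡0 p ∘ (_∘ attained-≤ p))

gap⇒internalZero : ∀ p {j} → 1 ≤ j → j ≤ maxRun p → j ∉ runs p → HasInternalZero p (suc (length p))
gap⇒internalZero p {j} 1≤j j≤M j∉ with foldr-selective ⊔-sel 0 (runs p)
... | inj₁ M≡0 = contradiction (≤-trans 1≤j (subst (j ≤_) M≡0 j≤M)) λ ()
... | inj₂ M∈  =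
  1 , suc j , suc (maxRun p) , s≤s 1≤j , s≤s j<M ,
  attained⇒B≢0 p (attained-one p) , attained⇒B≢0 p (attained-run p M∈) , ¬attained⇒B≡0 p missing
  where
  j<M : j < maxRun p
  j<M = ≤∧≢⇒< j≤M λ { refl → j∉ M∈ }
  missing : ¬ Attained (suc (length p)) p (suc j)
  missing att with attained-shape p att
  ... | inj₁ (s≤s j≤0)       = contradiction (≤-trans 1≤j j≤0) λ ()
  ... | inj₂ (r , r∈ , refl) = j∉ r∈

runsComplete⇒noInternalZero : ∀ p → (∀ j → 1 ≤ j → j ≤ maxRun p → j ∈ runs p) →
                              ¬ HasInternalZero p (suc (length p))
runsComplete⇒noInternalZero p complete (_ , zero , _ , () , _)
runsComplete⇒noInternalZero p complete (_ , suc zero , _ , _ , _ , _ , _ , B₁≡0) =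
  attained⇒B≢0 p (attained-one p) B₁≡0
runsComplete⇒noInternalZero p complete (_ , suc (suc j) , k₃ , _ , j+2<k₃ , _ , B₃≢0 , B≡0) =
  attained⇒B≢0 p (attained-run p (complete (suc j) (s≤s z≤n) j+1≤M)) B≡0
  where
  j+1≤M : suc j ≤ maxRun p
  j+1≤M = <⇒≤ (≤-pred (≤-trans j+2<k₃ (B≢0⇒≤ p B₃≢0)))

mainTheorem10 : ∀ (p : Word) → ¬ (p ≡ []) → ∀ (i : ℕ) → maxRun p ≡ i →
    ((¬ HasInternalZero p (suc (length p))) ⇔ (∀ (j : ℕ) → 1 ≤ j → j ≤ i → HasRunOfSize p j))
mainTheorem10 p _ .(maxRun p) refl = mk⇔
  (λ noZero j 1≤j j≤M → decidable-stable (j ∈? runs p) (noZero ∘ gap⇒internalZero p 1≤j j≤M))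
  (runsComplete⇒noInternalZero p)
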